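{- Let $E=\begin{bmatrix}\widetilde E & 0\\ 0 & 0\end{bmatrix}$ be realizable, and let $A=\begin{bmatrix}\widetilde A & X_1\\ X_2 & X_3\end{bmatrix}$ be a $(0,1)$ matrix partitioned compatibly with $E$, such that $A$ and $A+E$ are Gram mates. Suppose that $\tilde{\mathbf v}_1,\dots,\tilde{\mathbf v}_k$ form a basis of $\mathrm{Row}(\widetilde E)$, where for each $i$, $\tilde{\mathbf v}_i$ is a right singular vector of $\widetilde A$ associated to a positive singular value $\sigma_i$, and let $\tilde{\mathbf u}_i$ be the corresponding left singular vector (so $\widetilde A\tilde{\mathbf v}_i=\sigma_i\tilde{\mathbf u}_i$, $\widetilde A^T\tilde{\mathbf u}_i=\sigma_i\tilde{\mathbf v}_i$). Then for $i=1,\dots,k$, $\begin{bmatrix}\tilde{\mathbf v}_i\\0\end{bmatrix}$ (resp. $\begin{bmatrix}\tilde{\mathbf u}_i\\0\end{bmatrix}$) is a right (resp. left) singular vector of $A$ corresponding to $\sigma_i$.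
   Context: Two $(0,1)$ matrices $A,B$ are Gram mates if $AA^T=BB^T$, $A^TA=B^TB$ and $A\ne B$. A $(0,1,-1)$ matrix $E$ with $E\mathbf 1=0$, $\mathbf 1^TE=0^T$ is realizable if there is a pair of Gram mates $A$, $A+E$. $\mathrm{Row}(\widetilde E)$ is the row space of $\widetilde E$. -}

module Defs where

open import Level using (0ℓ)
open import Data.Nat using (ℕ; zero; suc)
import Data.Nat as ℕ
open import Data.Integer as ℤ using (ℤ; +_; -[1+_])
open import Data.Fin using (Fin; zero; suc; splitAt; _↑ˡ_)
open import Data.Sum using (_⊎_; inj₁; inj₂)
open import Data.Product using (Σ; ∃; _×_; _,_)
open import Relation.Nullary using (¬_)
open import Relation.Binary.PropositionalEquality using (_≡_; _≢_)
open import Algebra.Structures using (IsCommutativeRing)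
open import Relation.Binary.Structures using (IsStrictTotalOrder)

-- Integer matrices (entries of (0,1) and (0,1,-1) matrices live in ℤ)

Mat : ℕ → ℕ → Set
Mat m n = Fin m → Fin n → ℤ

sumℤ : ∀ {n} → (Fin n → ℤ) → ℤ
sumℤ {zero}  f = + 0
sumℤ {suc n} f = f zero ℤ.+ sumℤ (λ i → f (suc i))

_+ₘ_ : ∀ {m n} → Mat m n → Mat m n → Mat m n
(A +ₘ B) i j = A i j ℤ.+ B i j

MMᵀ : ∀ {m n} → Mat m n → Mat m m
MMᵀ M i i' = sumℤ (λ j → M i j ℤ.* M i' j)

MᵀM : ∀ {m n} → Mat m n → Mat n n
MᵀM M j j' = sumℤ (λ i → M i j ℤ.* M i j')

Is01 : ∀ {m n} → Mat m n → Set
Is01 M = ∀ i j → (M i j ≡ + 0) ⊎ (M i j ≡ + 1)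

Is01-1 : ∀ {m n} → Mat m n → Set
Is01-1 M = ∀ i j → (M i j ≡ + 0) ⊎ ((M i j ≡ + 1) ⊎ (M i j ≡ -[1+ 0 ]))

GramMates : ∀ {m n} → Mat m n → Mat m n → Set
GramMates A B =
  Is01 A × Is01 B ×
  (∀ i i' → MMᵀ A i i' ≡ MMᵀ B i i') ×
  (∀ j j' → MᵀM A j j' ≡ MᵀM B j j') ×
  ¬ (∀ i j → A i j ≡ B i j)

Realizable : ∀ {m n} → Mat m n → Set
Realizable {m} {n} E =
  Is01-1 E ×
  (∀ i → sumℤ (λ j → E i j) ≡ + 0) ×
  (∀ j → sumℤ (λ i → E i j) ≡ + 0) ×
  ∃ λ (A : Mat m n) → GramMates A (A +ₘ E)

blockE : ∀ {p q r s} → Mat p q → Mat (p ℕ.+ r) (q ℕ.+ s)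
blockE {p} {q} Ẽ i j with splitAt p i | splitAt q j
... | inj₁ a | inj₁ b = Ẽ a b
... | _      | _      = + 0

topLeft : ∀ {p q r s} → Mat (p ℕ.+ r) (q ℕ.+ s) → Mat p q
topLeft {r = r} {s = s} A i j = A (i ↑ˡ r) (j ↑ˡ s)

-- The real numbers, given axiomatically as a complete ordered field.
-- (Any two such structures are isomorphic, so quantifying over all of
-- them is the same as speaking about ℝ.)

record RealField : Set₁ where
  infixl 6 _+_
  infixl 7 _*_
  infix  4 _<_ _≤_
  field
    Carrier : Set
    _+_ _*_ : Carrier → Carrier → Carrier
    -_      : Carrier → Carrier
    0# 1#   : Carrier
    _<_     : Carrier → Carrier → Set
    isCommutativeRing  : IsCommutativeRing _≡_ _+_ _*_ -_ 0# 1#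
    0≢1                : 0# ≢ 1#
    inverse            : ∀ x → x ≢ 0# → ∃ λ y → x * y ≡ 1#
    isStrictTotalOrder : IsStrictTotalOrder _≡_ _<_
    +-mono-<           : ∀ x y z → x < y → x + z < y + z
    *-pos              : ∀ x y → 0# < x → 0# < y → 0# < x * y

  _≤_ : Carrier → Carrier → Set
  x ≤ y = (x < y) ⊎ (x ≡ y)

  field
    completeness : (P : Carrier → Set) → (∃ λ x → P x) →
                   (∃ λ b → ∀ x → P x → x ≤ b) →
                   ∃ λ s → (∀ x → P x → x ≤ s) ×
                           (∀ b → (∀ x → P x → x ≤ b) → s ≤ b)

module Real (ℝ : RealField) where
  open RealField ℝ public

  Vec : ℕ → Set
  Vec n = Fin n → Carrier

  sum : ∀ {n} → (Fin n → Carrier) → Carrier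
  sum {zero}  f = 0#
  sum {suc n} f = f zero + sum (λ i → f (suc i))

  fromℕ : ℕ → Carrier
  fromℕ zero    = 0#
  fromℕ (suc n) = 1# + fromℕ n

  fromℤ : ℤ → Carrier
  fromℤ (+ n)      = fromℕ n
  fromℤ -[1+ n ]   = - fromℕ (suc n)

  _·_ : ∀ {m n} → Mat m n → Vec n → Vec m
  (M · v) i = sum (λ j → fromℤ (M i j) * v j)

  _ᵀ·_ : ∀ {m n} → Mat m n → Vec m → Vec n
  (M ᵀ· u) j = sum (λ i → fromℤ (M i j) * u i)

  scale : ∀ {n} → Carrier → Vec n → Vec n
  scale c v i = c * v i

  NonZero : ∀ {n} → Vec n → Set
  NonZero v = ¬ (∀ j → v j ≡ 0#)

  SingularTriple : ∀ {m n} → Mat m n → Carrier → Vec m → Vec n → Set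
  SingularTriple M σ u v =
    (0# < σ) × NonZero u × NonZero v ×
    (∀ i → (M · v) i ≡ σ * u i) ×
    (∀ j → (M ᵀ· u) j ≡ σ * v j)

  InSpan : ∀ {k n} → (Fin k → Vec n) → Vec n → Set
  InSpan {k} vs w = ∃ λ (c : Fin k → Carrier) →
                      ∀ j → w j ≡ sum (λ i → c i * vs i j)

  LinIndep : ∀ {k n} → (Fin k → Vec n) → Set
  LinIndep {k} vs = ∀ (c : Fin k → Carrier) →
                      (∀ j → sum (λ i → c i * vs i j) ≡ 0#) → ∀ i → c i ≡ 0#

  InRow : ∀ {m n} → Mat m n → Vec n → Set
  InRow M w = InSpan (λ i j → fromℤ (M i j)) w

  IsBasisOfRow : ∀ {k m n} → Mat m n → (Fin k → Vec n) → Set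
  IsBasisOfRow M vs =
    (∀ i → InRow M (vs i)) × (∀ w → InRow M w → InSpan vs w) × LinIndep vs

  pad : ∀ {a} b → Vec a → Vec (a ℕ.+ b)
  pad {a} b x i with splitAt a i
  ... | inj₁ i' = x i'
  ... | inj₂ _  = 0#

{-# OPTIONS --safe #-}

-- Gram-mateness of A and A + E says A Eᵀ + E (A + E)ᵀ = 0 and Aᵀ E + Eᵀ (A + E) = 0.
-- Reading these at rows (columns) of A outside the support of E gives X₂ Ẽᵀ = 0
-- (X₁ᵀ Ẽ = 0), and at the upper rows Ã Ẽᵀ = - Ẽ (Ã + Ẽ)ᵀ.  Hence X₂ kills Row(Ẽ) ∋ vᵢ,
-- and σᵢ uᵢ = Ã vᵢ lies in the column space of Ẽ, which X₁ᵀ kills.  So the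
-- off-diagonal blocks of A do not see [vᵢ; 0] and [uᵢ; 0], and the singular triple
-- of Ã is one of A.

module Submission where

open import Level using (0ℓ)
open import Algebra using (CommutativeRing)
import Algebra.Properties.Ring as RingProperties
import Algebra.Properties.CommutativeSemigroup as CommutativeSemigroupProperties
import Algebra.Properties.Semiring.Mult as SemiringMult
import Algebra.Properties.Semiring.Sum as SemiringSum
open import Data.Nat as ℕ using (ℕ)
import Data.Nat.Properties as ℕ
open import Data.Fin using (Fin; zero; suc; splitAt; _↑ˡ_; _↑ʳ_)
open import Data.Fin.Properties using (splitAt-↑ˡ; splitAt-↑ʳ; splitAt⁻¹-↑ˡ; splitAt⁻¹-↑ʳ)
open import Data.Integer as ℤ using (ℤ; -[1+_]; _⊖_; _◃_; sign; ∣_∣)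
open import Data.Integer.Properties using ([1+m]⊖[1+n]≡m⊖n; ◃-inverse)
open import Data.Sign as Sign using (Sign)
open import Data.Sum using (inj₁; inj₂)
open import Data.Product using (_,_; proj₂)
open import Data.Vec.Functional using (take; transpose)
open import Relation.Binary.PropositionalEquality
open import Relation.Binary.Structures using (IsStrictTotalOrder)

open import Defs

↑-elim : ∀ {a b} {P : Fin (a ℕ.+ b) → Set} →
         (∀ i → P (i ↑ˡ b)) → (∀ t → P (a ↑ʳ t)) → ∀ k → P k
↑-elim {a} {b} {P} upper lower k with splitAt a {b} k in eq
... | inj₁ i = subst P (splitAt⁻¹-↑ˡ eq) (upper i)
... | inj₂ t = subst P (splitAt⁻¹-↑ʳ eq) (lower t)

module _ {p q r s : ℕ} (Ẽ : Mat p q) where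

  blockE-lower : ∀ t j → blockE {p} {q} {r} {s} Ẽ (p ↑ʳ t) j ≡ ℤ.+ 0
  blockE-lower t j rewrite splitAt-↑ʳ p r t = refl

  blockE-right : ∀ i t → blockE {p} {q} {r} {s} Ẽ i (q ↑ʳ t) ≡ ℤ.+ 0
  blockE-right i t rewrite splitAt-↑ʳ q s t with splitAt p {r} i
  ... | inj₁ _ = refl
  ... | inj₂ _ = refl

module LinearAlgebra (ℝ : RealField) where
  open Real ℝ

  commutativeRing : CommutativeRing 0ℓ 0ℓ
  commutativeRing = record { isCommutativeRing = isCommutativeRing }

  open CommutativeRing commutativeRing
    using ( +-assoc; +-comm; +-identityˡ; +-identityʳ; -‿inverse; *-assoc; *-comm
          ; *-identityˡ; *-identityʳ; zeroˡ; zeroʳ; distribˡ; distribʳ; ring; semiring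
          ; +-commutativeSemigroup; *-commutativeSemigroup )
  open RingProperties ring
    using (-0#≈0#; -‿involutive; -‿+-comm; +-identityʳ-unique; +-inverseˡ-unique; -1*x≈-x)
  open SemiringMult semiring using (_×_; ×-homo-+; ×1-homo-*)
  open SemiringSum semiring
    using (sum-syntax; *-distribˡ-sum; ∑-distrib-+; ∑-comm; sum-cong-≗; sum-replicate-zero)
  open CommutativeSemigroupProperties +-commutativeSemigroup using (interchange)
  open CommutativeSemigroupProperties *-commutativeSemigroup
    renaming (interchange to *-interchange) using (x∙yz≈y∙xz)
  open ≡-Reasoning

  *-cancelˡ-pos : ∀ {c w} → 0# < c → c * w ≡ 0# → w ≡ 0#
  *-cancelˡ-pos {c} {w} c>0 cw≡0
    with inverse c (λ c≡0 → IsStrictTotalOrder.irrefl isStrictTotalOrder (sym c≡0) c>0)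
  ... | c⁻¹ , cc⁻¹≡1 = begin
    w              ≡⟨ *-identityˡ w ⟨
    1# * w         ≡⟨ cong (_* w) (trans (sym cc⁻¹≡1) (*-comm c c⁻¹)) ⟩
    c⁻¹ * c * w    ≡⟨ *-assoc c⁻¹ c w ⟩
    c⁻¹ * (c * w)  ≡⟨ cong (c⁻¹ *_) cw≡0 ⟩
    c⁻¹ * 0#       ≡⟨ zeroʳ c⁻¹ ⟩
    0#             ∎

  sum≡∑ : ∀ {n} (f : Vec n) → sum f ≡ ∑[ i < n ] f i
  sum≡∑ {ℕ.zero}  f = refl
  sum≡∑ {ℕ.suc n} f = cong (f zero +_) (sum≡∑ (λ i → f (suc i)))

  ∑-↑ : ∀ {a b} (f : Vec (a ℕ.+ b)) →
        ∑[ k < a ℕ.+ b ] f k ≡ ∑[ i < a ] f (i ↑ˡ b) + ∑[ t < b ] f (a ↑ʳ t)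
  ∑-↑ {ℕ.zero}  f = sym (+-identityˡ _)
  ∑-↑ {ℕ.suc a} f = trans (cong (f zero +_) (∑-↑ {a} (λ k → f (suc k)))) (sym (+-assoc _ _ _))

  infix 7 _∙_
  _∙_ : ∀ {n} → Vec n → Vec n → Carrier
  _∙_ {n} x y = ∑[ j < n ] (x j * y j)

  module _ {n : ℕ} where

    ∙-cong : ∀ {x x′ y y′ : Vec n} → (∀ j → x j ≡ x′ j) → (∀ j → y j ≡ y′ j) → x ∙ y ≡ x′ ∙ y′
    ∙-cong x≗x′ y≗y′ = sum-cong-≗ (λ j → cong₂ _*_ (x≗x′ j) (y≗y′ j))

    ∙-congˡ : ∀ {x : Vec n} {y y′ : Vec n} → (∀ j → y j ≡ y′ j) → x ∙ y ≡ x ∙ y′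
    ∙-congˡ = ∙-cong (λ _ → refl)

    ∙-comm : ∀ (x y : Vec n) → x ∙ y ≡ y ∙ x
    ∙-comm x y = sum-cong-≗ (λ j → *-comm (x j) (y j))

    ∙-zeroˡ : ∀ {x : Vec n} (y : Vec n) → (∀ j → x j ≡ 0#) → x ∙ y ≡ 0#
    ∙-zeroˡ y x≡0 = trans (sum-cong-≗ (λ j → trans (cong (_* y j) (x≡0 j)) (zeroˡ (y j))))
                          (sum-replicate-zero n)

    ∙-zeroʳ : ∀ (x : Vec n) {y : Vec n} → (∀ j → y j ≡ 0#) → x ∙ y ≡ 0#
    ∙-zeroʳ x y≡0 = trans (∙-comm x _) (∙-zeroˡ x y≡0)

    ∙-distribʳ-+ : ∀ (x x′ y : Vec n) → (λ j → x j + x′ j) ∙ y ≡ x ∙ y + x′ ∙ y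
    ∙-distribʳ-+ x x′ y = trans (sum-cong-≗ (λ j → distribʳ (y j) (x j) (x′ j)))
                                (∑-distrib-+ (λ j → x j * y j) (λ j → x′ j * y j))

    ∙-distribˡ-+ : ∀ (x y y′ : Vec n) → x ∙ (λ j → y j + y′ j) ≡ x ∙ y + x ∙ y′
    ∙-distribˡ-+ x y y′ = trans (sum-cong-≗ (λ j → distribˡ (x j) (y j) (y′ j)))
                                (∑-distrib-+ (λ j → x j * y j) (λ j → x j * y′ j))

    ∙-scaleʳ : ∀ (x : Vec n) c (y : Vec n) → x ∙ scale c y ≡ c * (x ∙ y)
    ∙-scaleʳ x c y = begin
      ∑[ j < n ] (x j * (c * y j))  ≡⟨ sum-cong-≗ (λ j → x∙yz≈y∙xz (x j) c (y j)) ⟩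
      ∑[ j < n ] (c * (x j * y j))  ≡⟨ *-distribˡ-sum c (λ j → x j * y j) ⟨
      c * (x ∙ y)                   ∎

    ∙-negʳ : ∀ (x y : Vec n) → x ∙ (λ j → - y j) ≡ - (x ∙ y)
    ∙-negʳ x y = begin
      x ∙ (λ j → - y j)   ≡⟨ ∙-congˡ (λ j → sym (-1*x≈-x (y j))) ⟩
      x ∙ scale (- 1#) y  ≡⟨ ∙-scaleʳ x (- 1#) y ⟩
      - 1# * (x ∙ y)      ≡⟨ -1*x≈-x (x ∙ y) ⟩
      - (x ∙ y)           ∎

    ∙-∑ʳ : ∀ {k} (x : Vec n) (c : Fin k → Carrier) (w : Fin k → Vec n) →
           x ∙ (λ j → ∑[ l < k ] (c l * w l j)) ≡ ∑[ l < k ] (c l * (x ∙ w l))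
    ∙-∑ʳ {k} x c w = begin
      ∑[ j < n ] (x j * ∑[ l < k ] (c l * w l j))
        ≡⟨ sum-cong-≗ (λ j → *-distribˡ-sum (x j) (λ l → c l * w l j)) ⟩
      ∑[ j < n ] ∑[ l < k ] (x j * (c l * w l j))
        ≡⟨ ∑-comm (λ j l → x j * (c l * w l j)) ⟩
      ∑[ l < k ] ∑[ j < n ] (x j * (c l * w l j))
        ≡⟨ sum-cong-≗ (λ l → ∙-scaleʳ x (c l) (w l)) ⟩
      ∑[ l < k ] (c l * (x ∙ w l))
        ∎

    ∙-vanishes-on-span : ∀ {k} {x y : Vec n} {w : Fin k → Vec n} →
                         (∀ l → x ∙ w l ≡ 0#) → InSpan w y → x ∙ y ≡ 0#
    ∙-vanishes-on-span {k} {x} {y} {w} x⊥w (c , y≡cw) = begin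
      x ∙ y                                   ≡⟨ ∙-congˡ (λ j → trans (y≡cw j) (sum≡∑ (λ l → c l * w l j))) ⟩
      x ∙ (λ j → ∑[ l < k ] (c l * w l j))    ≡⟨ ∙-∑ʳ x c w ⟩
      ∑[ l < k ] (c l * (x ∙ w l))            ≡⟨ sum-cong-≗ (λ l → trans (cong (c l *_) (x⊥w l)) (zeroʳ (c l))) ⟩
      ∑[ l < k ] 0#                           ≡⟨ sum-replicate-zero k ⟩
      0#                                      ∎

    ∙-vanishes-on-scaled-span : ∀ {k σ} {x u y : Vec n} {w : Fin k → Vec n} → 0# < σ →
                                (∀ j → y j ≡ σ * u j) → InSpan w y → (∀ l → x ∙ w l ≡ 0#) →
                                x ∙ u ≡ 0#
    ∙-vanishes-on-scaled-span {σ = σ} {x} {u} {y} σ>0 y≡σu y∈span x⊥w = *-cancelˡ-pos σ>0 (begin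
      σ * (x ∙ u)    ≡⟨ ∙-scaleʳ x σ u ⟨
      x ∙ scale σ u  ≡⟨ ∙-congˡ (λ j → sym (y≡σu j)) ⟩
      x ∙ y          ≡⟨ ∙-vanishes-on-span x⊥w y∈span ⟩
      0#             ∎)

    ∙-cross : ∀ (x x′ y y′ : Vec n) → x ∙ y ≡ (λ j → x j + x′ j) ∙ (λ j → y j + y′ j) →
              x ∙ y′ + x′ ∙ (λ j → y j + y′ j) ≡ 0#
    ∙-cross x x′ y y′ gram = +-identityʳ-unique (x ∙ y) _ (begin
      x ∙ y + (x ∙ y′ + x′ ∙ y+y′)  ≡⟨ +-assoc _ _ _ ⟨
      x ∙ y + x ∙ y′ + x′ ∙ y+y′    ≡⟨ cong (_+ x′ ∙ y+y′) (∙-distribˡ-+ x y y′) ⟨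
      x ∙ y+y′ + x′ ∙ y+y′          ≡⟨ ∙-distribʳ-+ x x′ y+y′ ⟨
      (λ j → x j + x′ j) ∙ y+y′     ≡⟨ gram ⟨
      x ∙ y                         ∎)
      where
      y+y′ : Vec n
      y+y′ j = y j + y′ j

  module _ {a b : ℕ} where

    pad-↑ˡ : ∀ (x : Vec a) i → pad b x (i ↑ˡ b) ≡ x i
    pad-↑ˡ x i rewrite splitAt-↑ˡ a i b = refl

    pad-↑ʳ : ∀ (x : Vec a) t → pad b x (a ↑ʳ t) ≡ 0#
    pad-↑ʳ x t rewrite splitAt-↑ʳ a b t = refl

    pad-NonZero : ∀ {x : Vec a} → NonZero x → NonZero (pad b x)
    pad-NonZero {x} x≢0 pad≡0 = x≢0 (λ i → trans (sym (pad-↑ˡ x i)) (pad≡0 (i ↑ˡ b)))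

    ∙-padʳ : ∀ (x : Vec (a ℕ.+ b)) (y : Vec a) → x ∙ pad b y ≡ take a x ∙ y
    ∙-padʳ x y = begin
      x ∙ pad b y
        ≡⟨ ∑-↑ {a} _ ⟩
      take a x ∙ (λ i → pad b y (i ↑ˡ b)) + x↑ʳ ∙ (λ t → pad b y (a ↑ʳ t))
        ≡⟨ cong₂ _+_ (∙-congˡ (pad-↑ˡ y)) (∙-zeroʳ x↑ʳ (pad-↑ʳ y)) ⟩
      take a x ∙ y + 0#
        ≡⟨ +-identityʳ _ ⟩
      take a x ∙ y
        ∎
      where
      x↑ʳ : Vec b
      x↑ʳ t = x (a ↑ʳ t)

  fromℕ≡×1# : ∀ n → fromℕ n ≡ n × 1#
  fromℕ≡×1# ℕ.zero    = refl
  fromℕ≡×1# (ℕ.suc n) = cong (1# +_) (fromℕ≡×1# n)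

  fromℕ-+ : ∀ m n → fromℕ (m ℕ.+ n) ≡ fromℕ m + fromℕ n
  fromℕ-+ m n = begin
    fromℕ (m ℕ.+ n)    ≡⟨ fromℕ≡×1# (m ℕ.+ n) ⟩
    (m ℕ.+ n) × 1#     ≡⟨ ×-homo-+ 1# m n ⟩
    m × 1# + n × 1#    ≡⟨ cong₂ _+_ (fromℕ≡×1# m) (fromℕ≡×1# n) ⟨
    fromℕ m + fromℕ n  ∎

  fromℕ-* : ∀ m n → fromℕ (m ℕ.* n) ≡ fromℕ m * fromℕ n
  fromℕ-* m n = begin
    fromℕ (m ℕ.* n)    ≡⟨ fromℕ≡×1# (m ℕ.* n) ⟩
    (m ℕ.* n) × 1#     ≡⟨ ×1-homo-* m n ⟩
    m × 1# * n × 1#    ≡⟨ cong₂ _*_ (fromℕ≡×1# m) (fromℕ≡×1# n) ⟨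
    fromℕ m * fromℕ n  ∎

  fromℤ-⊖ : ∀ m n → fromℤ (m ⊖ n) ≡ fromℕ m + - fromℕ n
  fromℤ-⊖ m         ℕ.zero    = sym (trans (cong (fromℕ m +_) -0#≈0#) (+-identityʳ _))
  fromℤ-⊖ ℕ.zero    (ℕ.suc n) = sym (+-identityˡ _)
  fromℤ-⊖ (ℕ.suc m) (ℕ.suc n) = begin
    fromℤ (ℕ.suc m ⊖ ℕ.suc n)            ≡⟨ cong fromℤ ([1+m]⊖[1+n]≡m⊖n m n) ⟩
    fromℤ (m ⊖ n)                        ≡⟨ fromℤ-⊖ m n ⟩
    fromℕ m + - fromℕ n                  ≡⟨ +-identityˡ _ ⟨
    0# + (fromℕ m + - fromℕ n)           ≡⟨ cong (_+ (fromℕ m + - fromℕ n)) (proj₂ -‿inverse 1#) ⟨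
    (1# + - 1#) + (fromℕ m + - fromℕ n)  ≡⟨ interchange 1# (- 1#) (fromℕ m) (- fromℕ n) ⟩
    (1# + fromℕ m) + (- 1# + - fromℕ n)  ≡⟨ cong (1# + fromℕ m +_) (-‿+-comm 1# (fromℕ n)) ⟩
    (1# + fromℕ m) + - (1# + fromℕ n)    ∎

  fromℤ-+ : ∀ x y → fromℤ (x ℤ.+ y) ≡ fromℤ x + fromℤ y
  fromℤ-+ -[1+ m ] -[1+ n ] = begin
    - fromℕ (ℕ.suc (ℕ.suc (m ℕ.+ n)))      ≡⟨ cong (λ k → - fromℕ (ℕ.suc k)) (ℕ.+-suc m n) ⟨
    - fromℕ (ℕ.suc m ℕ.+ ℕ.suc n)          ≡⟨ cong -_ (fromℕ-+ (ℕ.suc m) (ℕ.suc n)) ⟩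
    - (fromℕ (ℕ.suc m) + fromℕ (ℕ.suc n))  ≡⟨ -‿+-comm _ _ ⟨
    - fromℕ (ℕ.suc m) + - fromℕ (ℕ.suc n)  ∎
  fromℤ-+ -[1+ m ] (ℤ.+ n)  = trans (fromℤ-⊖ n (ℕ.suc m)) (+-comm _ _)
  fromℤ-+ (ℤ.+ m)  -[1+ n ] = fromℤ-⊖ m (ℕ.suc n)
  fromℤ-+ (ℤ.+ m)  (ℤ.+ n)  = fromℕ-+ m n

  fromSign : Sign → Carrier
  fromSign Sign.+ = 1#
  fromSign Sign.- = - 1#

  fromSign-* : ∀ s t → fromSign (s Sign.* t) ≡ fromSign s * fromSign t
  fromSign-* Sign.+ t      = sym (*-identityˡ _)
  fromSign-* Sign.- Sign.+ = sym (*-identityʳ (- 1#))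
  fromSign-* Sign.- Sign.- = sym (trans (-1*x≈-x (- 1#)) (-‿involutive 1#))

  fromℤ-◃ : ∀ s n → fromℤ (s ◃ n) ≡ fromSign s * fromℕ n
  fromℤ-◃ s      ℕ.zero    = sym (zeroʳ _)
  fromℤ-◃ Sign.+ (ℕ.suc n) = sym (*-identityˡ _)
  fromℤ-◃ Sign.- (ℕ.suc n) = sym (-1*x≈-x _)

  fromℤ≡sign*∣∣ : ∀ z → fromℤ z ≡ fromSign (sign z) * fromℕ ∣ z ∣
  fromℤ≡sign*∣∣ z = trans (cong fromℤ (sym (◃-inverse z))) (fromℤ-◃ (sign z) ∣ z ∣)

  fromℤ-* : ∀ x y → fromℤ (x ℤ.* y) ≡ fromℤ x * fromℤ y
  fromℤ-* x y = begin
    fromℤ (x ℤ.* y)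
      ≡⟨ fromℤ-◃ (sign x Sign.* sign y) (∣ x ∣ ℕ.* ∣ y ∣) ⟩
    fromSign (sign x Sign.* sign y) * fromℕ (∣ x ∣ ℕ.* ∣ y ∣)
      ≡⟨ cong₂ _*_ (fromSign-* (sign x) (sign y)) (fromℕ-* ∣ x ∣ ∣ y ∣) ⟩
    fromSign (sign x) * fromSign (sign y) * (fromℕ ∣ x ∣ * fromℕ ∣ y ∣)
      ≡⟨ *-interchange _ _ _ _ ⟩
    fromSign (sign x) * fromℕ ∣ x ∣ * (fromSign (sign y) * fromℕ ∣ y ∣)
      ≡⟨ cong₂ _*_ (fromℤ≡sign*∣∣ x) (fromℤ≡sign*∣∣ y) ⟨
    fromℤ x * fromℤ y
      ∎

  fromℤ-sumℤ : ∀ {n} (f : Fin n → ℤ) → fromℤ (sumℤ f) ≡ ∑[ i < n ] fromℤ (f i)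
  fromℤ-sumℤ {ℕ.zero}  f = refl
  fromℤ-sumℤ {ℕ.suc n} f =
    trans (fromℤ-+ (f zero) _) (cong (fromℤ (f zero) +_) (fromℤ-sumℤ (λ i → f (suc i))))

  ⟦_⟧ : ∀ {m n} → Mat m n → Fin m → Vec n
  ⟦ M ⟧ i j = fromℤ (M i j)

  ·≡∙ : ∀ {m n} (M : Mat m n) (v : Vec n) i → (M · v) i ≡ ⟦ M ⟧ i ∙ v
  ·≡∙ M v i = sum≡∑ (λ j → fromℤ (M i j) * v j)

  fromℤ-MMᵀ : ∀ {m n} (M : Mat m n) i i′ → fromℤ (MMᵀ M i i′) ≡ ⟦ M ⟧ i ∙ ⟦ M ⟧ i′
  fromℤ-MMᵀ M i i′ =
    trans (fromℤ-sumℤ (λ j → M i j ℤ.* M i′ j)) (sum-cong-≗ (λ j → fromℤ-* (M i j) (M i′ j)))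

  SameRowGram : ∀ {m n} → Mat m n → Mat m n → Set
  SameRowGram A B = ∀ i i′ → MMᵀ A i i′ ≡ MMᵀ B i i′

  module _ {m n : ℕ} (A E : Mat m n) (gram : SameRowGram A (A +ₘ E)) where

    gram-cross : ∀ i i′ → ⟦ A ⟧ i ∙ ⟦ E ⟧ i′ + ⟦ E ⟧ i ∙ ⟦ A +ₘ E ⟧ i′ ≡ 0#
    gram-cross i i′ = begin
      ⟦ A ⟧ i ∙ ⟦ E ⟧ i′ + ⟦ E ⟧ i ∙ ⟦ A +ₘ E ⟧ i′
        ≡⟨ cong (⟦ A ⟧ i ∙ ⟦ E ⟧ i′ +_) (∙-congˡ (⟦A+E⟧ i′)) ⟩
      ⟦ A ⟧ i ∙ ⟦ E ⟧ i′ + ⟦ E ⟧ i ∙ A+E i′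
        ≡⟨ ∙-cross (⟦ A ⟧ i) (⟦ E ⟧ i) (⟦ A ⟧ i′) (⟦ E ⟧ i′) gramℝ ⟩
      0#
        ∎
      where
      A+E : Fin m → Vec n
      A+E i j = ⟦ A ⟧ i j + ⟦ E ⟧ i j
      ⟦A+E⟧ : ∀ i j → ⟦ A +ₘ E ⟧ i j ≡ A+E i j
      ⟦A+E⟧ i j = fromℤ-+ (A i j) (E i j)
      gramℝ : ⟦ A ⟧ i ∙ ⟦ A ⟧ i′ ≡ A+E i ∙ A+E i′
      gramℝ = begin
        ⟦ A ⟧ i ∙ ⟦ A ⟧ i′            ≡⟨ fromℤ-MMᵀ A i i′ ⟨
        fromℤ (MMᵀ A i i′)            ≡⟨ cong fromℤ (gram i i′) ⟩
        fromℤ (MMᵀ (A +ₘ E) i i′)     ≡⟨ fromℤ-MMᵀ (A +ₘ E) i i′ ⟩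
        ⟦ A +ₘ E ⟧ i ∙ ⟦ A +ₘ E ⟧ i′  ≡⟨ ∙-cong (⟦A+E⟧ i) (⟦A+E⟧ i′) ⟩
        A+E i ∙ A+E i′                ∎

    gram-zero-row : ∀ {i} → (∀ j → E i j ≡ ℤ.+ 0) → ∀ i′ → ⟦ A ⟧ i ∙ ⟦ E ⟧ i′ ≡ 0#
    gram-zero-row {i} Eᵢ≡0 i′ = begin
      ⟦ A ⟧ i ∙ ⟦ E ⟧ i′
        ≡⟨ +-identityʳ _ ⟨
      ⟦ A ⟧ i ∙ ⟦ E ⟧ i′ + 0#
        ≡⟨ cong (⟦ A ⟧ i ∙ ⟦ E ⟧ i′ +_) (∙-zeroˡ (⟦ A +ₘ E ⟧ i′) (λ j → cong fromℤ (Eᵢ≡0 j))) ⟨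
      ⟦ A ⟧ i ∙ ⟦ E ⟧ i′ + ⟦ E ⟧ i ∙ ⟦ A +ₘ E ⟧ i′
        ≡⟨ gram-cross i i′ ⟩
      0#
        ∎

  module _ {p q r s : ℕ} (Ẽ : Mat p q) where

    ⟦blockE⟧-upper : ∀ i J → ⟦ blockE {p} {q} {r} {s} Ẽ ⟧ (i ↑ˡ r) J ≡ pad s (⟦ Ẽ ⟧ i) J
    ⟦blockE⟧-upper i J rewrite splitAt-↑ˡ p i r with splitAt q {s} J
    ... | inj₁ _ = refl
    ... | inj₂ _ = refl

    ⟦blockE⟧-left : ∀ j I →
                    ⟦ transpose (blockE {p} {q} {r} {s} Ẽ) ⟧ (j ↑ˡ s) I ≡ pad r (⟦ transpose Ẽ ⟧ j) I
    ⟦blockE⟧-left j I rewrite splitAt-↑ˡ q j s with splitAt p {r} I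
    ... | inj₁ _ = refl
    ... | inj₂ _ = refl

  -- Only rows are treated: MᵀM A is MMᵀ (transpose A) by definition, so the column
  -- statements are these applied to transposes.
  module BlockRows {p q r s : ℕ} (A E : Mat (p ℕ.+ r) (q ℕ.+ s)) (Ẽ : Mat p q)
                   (gram : SameRowGram A (A +ₘ E))
                   (E-lower : ∀ t j → E (p ↑ʳ t) j ≡ ℤ.+ 0)
                   (E-upper : ∀ i j → ⟦ E ⟧ (i ↑ˡ r) j ≡ pad s (⟦ Ẽ ⟧ i) j) where

    ∙-E-upper : ∀ (x : Vec (q ℕ.+ s)) l → x ∙ ⟦ E ⟧ (l ↑ˡ r) ≡ take q x ∙ ⟦ Ẽ ⟧ l
    ∙-E-upper x l = trans (∙-congˡ (E-upper l)) (∙-padʳ x (⟦ Ẽ ⟧ l))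

    lower⊥Ẽ : ∀ t l → take q (⟦ A ⟧ (p ↑ʳ t)) ∙ ⟦ Ẽ ⟧ l ≡ 0#
    lower⊥Ẽ t l =
      trans (sym (∙-E-upper (⟦ A ⟧ (p ↑ʳ t)) l)) (gram-zero-row A E gram (E-lower t) (l ↑ˡ r))

    upper-cross : ∀ i l → ⟦ topLeft {p} {q} {r} {s} A ⟧ i ∙ ⟦ Ẽ ⟧ l
                          + take q (⟦ A +ₘ E ⟧ (l ↑ˡ r)) ∙ ⟦ Ẽ ⟧ i ≡ 0#
    upper-cross i l = begin
      take q (⟦ A ⟧ (i ↑ˡ r)) ∙ ⟦ Ẽ ⟧ l + take q (⟦ A +ₘ E ⟧ (l ↑ˡ r)) ∙ ⟦ Ẽ ⟧ i
        ≡⟨ cong₂ _+_ (∙-E-upper (⟦ A ⟧ (i ↑ˡ r)) l) (∙-E-upper (⟦ A +ₘ E ⟧ (l ↑ˡ r)) i) ⟨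
      ⟦ A ⟧ (i ↑ˡ r) ∙ ⟦ E ⟧ (l ↑ˡ r) + ⟦ A +ₘ E ⟧ (l ↑ˡ r) ∙ ⟦ E ⟧ (i ↑ˡ r)
        ≡⟨ cong (⟦ A ⟧ (i ↑ˡ r) ∙ ⟦ E ⟧ (l ↑ˡ r) +_) (∙-comm (⟦ A +ₘ E ⟧ (l ↑ˡ r)) _) ⟩
      ⟦ A ⟧ (i ↑ˡ r) ∙ ⟦ E ⟧ (l ↑ˡ r) + ⟦ E ⟧ (i ↑ˡ r) ∙ ⟦ A +ₘ E ⟧ (l ↑ˡ r)
        ≡⟨ gram-cross A E gram (i ↑ˡ r) (l ↑ˡ r) ⟩
      0#
        ∎

    topLeft·-InColumnSpan : ∀ {v} → InRow Ẽ v →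
                            InSpan (transpose ⟦ Ẽ ⟧) (topLeft {p} {q} {r} {s} A · v)
    -- Ã v = Ã Ẽᵀ c = - Ẽ (Ã + Ẽ)ᵀ c, so the coefficients are d = - (Ã + Ẽ)ᵀ c.
    topLeft·-InColumnSpan {v} (c , v≡cẼ) = d , λ i → begin
      (Ã · v) i                                   ≡⟨ ·≡∙ Ã v i ⟩
      ⟦ Ã ⟧ i ∙ v                                 ≡⟨ ∙-congˡ v≡∑cẽ ⟩
      ⟦ Ã ⟧ i ∙ (λ j → ∑[ l < p ] (c l * ẽ l j))  ≡⟨ ∙-∑ʳ (⟦ Ã ⟧ i) c ẽ ⟩
      ∑[ l < p ] (c l * (⟦ Ã ⟧ i ∙ ẽ l))          ≡⟨ sum-cong-≗ (λ l → cong (c l *_) (Ã∙Ẽ i l)) ⟩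
      ∑[ l < p ] (c l * (ẽ i ∙ -w l))             ≡⟨ ∙-∑ʳ (ẽ i) c -w ⟨
      ẽ i ∙ d                                     ≡⟨ ∙-comm (ẽ i) d ⟩
      d ∙ ẽ i                                     ≡⟨ sum≡∑ (λ j → d j * ẽ i j) ⟨
      sum (λ j → d j * ẽ i j)                     ∎
      where
      Ã : Mat p q
      Ã = topLeft {p} {q} {r} {s} A
      ẽ : Fin p → Vec q
      ẽ = ⟦ Ẽ ⟧
      v≡∑cẽ : ∀ j → v j ≡ ∑[ l < p ] (c l * ẽ l j)
      v≡∑cẽ j = trans (v≡cẼ j) (sum≡∑ (λ l → c l * ẽ l j))
      -w : Fin p → Vec q
      -w l j = - take q (⟦ A +ₘ E ⟧ (l ↑ˡ r)) j
      d : Vec q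
      d j = ∑[ l < p ] (c l * -w l j)
      Ã∙Ẽ : ∀ i l → ⟦ Ã ⟧ i ∙ ẽ l ≡ ẽ i ∙ -w l
      Ã∙Ẽ i l = begin
        ⟦ Ã ⟧ i ∙ ẽ l                           ≡⟨ +-inverseˡ-unique _ _ (upper-cross i l) ⟩
        - (take q (⟦ A +ₘ E ⟧ (l ↑ˡ r)) ∙ ẽ i)  ≡⟨ cong -_ (∙-comm _ (ẽ i)) ⟩
        - (ẽ i ∙ take q (⟦ A +ₘ E ⟧ (l ↑ˡ r)))  ≡⟨ ∙-negʳ (ẽ i) _ ⟨
        ẽ i ∙ -w l                              ∎

  ·-pad : ∀ {p q r s} (A : Mat (p ℕ.+ r) (q ℕ.+ s)) {σ u v} →
          (∀ i → (topLeft {p} {q} {r} {s} A · v) i ≡ σ * u i) →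
          (∀ t → take q (⟦ A ⟧ (p ↑ʳ t)) ∙ v ≡ 0#) →
          ∀ k → (A · pad s v) k ≡ σ * pad r u k
  ·-pad {p} {q} {r} {s} A {σ} {u} {v} Ãv≡σu X₂v≡0 =
    ↑-elim {P = λ k → (A · pad s v) k ≡ σ * pad r u k} upper lower
    where
    A·pad : ∀ k → (A · pad s v) k ≡ take q (⟦ A ⟧ k) ∙ v
    A·pad k = trans (·≡∙ A (pad s v) k) (∙-padʳ (⟦ A ⟧ k) v)
    upper : ∀ i → (A · pad s v) (i ↑ˡ r) ≡ σ * pad r u (i ↑ˡ r)
    upper i = begin
      (A · pad s v) (i ↑ˡ r)             ≡⟨ A·pad (i ↑ˡ r) ⟩
      take q (⟦ A ⟧ (i ↑ˡ r)) ∙ v        ≡⟨ ·≡∙ (topLeft {p} {q} {r} {s} A) v i ⟨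
      (topLeft {p} {q} {r} {s} A · v) i  ≡⟨ Ãv≡σu i ⟩
      σ * u i                            ≡⟨ cong (σ *_) (pad-↑ˡ u i) ⟨
      σ * pad r u (i ↑ˡ r)               ∎
    lower : ∀ t → (A · pad s v) (p ↑ʳ t) ≡ σ * pad r u (p ↑ʳ t)
    lower t = begin
      (A · pad s v) (p ↑ʳ t)             ≡⟨ A·pad (p ↑ʳ t) ⟩
      take q (⟦ A ⟧ (p ↑ʳ t)) ∙ v        ≡⟨ X₂v≡0 t ⟩
      0#                                 ≡⟨ zeroʳ σ ⟨
      σ * 0#                             ≡⟨ cong (σ *_) (pad-↑ʳ u t) ⟨
      σ * pad r u (p ↑ʳ t)               ∎

  SingularTriple-pad : ∀ {p q r s} (A : Mat (p ℕ.+ r) (q ℕ.+ s)) {σ u v} →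
                       SingularTriple (topLeft {p} {q} {r} {s} A) σ u v →
                       (∀ t → take q (⟦ A ⟧ (p ↑ʳ t)) ∙ v ≡ 0#) →
                       (∀ t → take p (⟦ transpose A ⟧ (q ↑ʳ t)) ∙ u ≡ 0#) →
                       SingularTriple A σ (pad r u) (pad s v)
  SingularTriple-pad {p} {q} {r} {s} A {σ} {u} {v}
                     (σ>0 , u≢0 , v≢0 , Ãv≡σu , Ãᵀu≡σv) X₂v≡0 X₁ᵀu≡0 =
    σ>0 , pad-NonZero u≢0 , pad-NonZero v≢0 ,
    ·-pad {p} {q} {r} {s} A {σ} {u} {v} Ãv≡σu X₂v≡0 ,
    ·-pad {q} {p} {s} {r} (transpose A) {σ} {v} {u} Ãᵀu≡σv X₁ᵀu≡0

proposition4p5 :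
    (ℝ : RealField) → let open Real ℝ in
    (p q r s k : ℕ) (Ẽ : Mat p q) → Realizable (blockE {p} {q} {r} {s} Ẽ) →
    (A : Mat (p ℕ.+ r) (q ℕ.+ s)) → GramMates A (A +ₘ blockE Ẽ) →
    (σ : Fin k → Carrier) (u : Fin k → Vec p) (v : Fin k → Vec q) →
    IsBasisOfRow Ẽ v →
    (∀ i → SingularTriple (topLeft {p} {q} {r} {s} A) (σ i) (u i) (v i)) →
    ∀ i → SingularTriple A (σ i) (pad r (u i)) (pad s (v i))
proposition4p5 ℝ p q r s k Ẽ _ A (_ , _ , rowGram , colGram , _) σ u v (v∈Row , _ , _) triple i
  with triple i
... | tripleᵢ@(σ>0 , _ , _ , Ãv≡σu , _) = SingularTriple-pad A tripleᵢ X₂v≡0 X₁ᵀu≡0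
  where
  open Real ℝ
  open LinearAlgebra ℝ
  E : Mat (p ℕ.+ r) (q ℕ.+ s)
  E = blockE {p} {q} {r} {s} Ẽ
  module Rows = BlockRows A E Ẽ rowGram (blockE-lower Ẽ) (⟦blockE⟧-upper Ẽ)
  module Cols = BlockRows (transpose A) (transpose E) (transpose Ẽ) colGram
                          (λ t j → blockE-right Ẽ j t) (⟦blockE⟧-left Ẽ)
  X₂v≡0 : ∀ t → take q (⟦ A ⟧ (p ↑ʳ t)) ∙ v i ≡ 0#
  X₂v≡0 t = ∙-vanishes-on-span (Rows.lower⊥Ẽ t) (v∈Row i)
  X₁ᵀu≡0 : ∀ t → take p (⟦ transpose A ⟧ (q ↑ʳ t)) ∙ u i ≡ 0#
  X₁ᵀu≡0 t = ∙-vanishes-on-scaled-span σ>0 Ãv≡σu (Rows.topLeft·-InColumnSpan (v∈Row i))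
                                       (Cols.lower⊥Ẽ t)
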